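{- Let $P,Q\in\mathbb{Z}$ with $PQ\neq 0$, let $p\geq 3$ be a prime dividing both $P$ and $Q$, and write $P=p^aP'$, $Q=p^bQ'$ with $a,b\geq 1$ and $p\nmid P'Q'$. Suppose $b=2a$ and let $r\geq 1$ be an integer. Then \[ \mathcal{L}(P,Q,p^{ -r})=S_{\lceil (r+a)/a\rceil}\cup\Big\{n\in\langle\rho'\rangle : \nu_p\big(\tfrac{n}{\rho'}\big)\geq r+a-an-\nu'\Big\}. \] Moreover, if $\rho'\geq\lceil (r+a)/a\rceil$, then $\mathcal{L}(P,Q,p^{ -r})=S_{\lceil (r+a)/a\rceil}$.
   Context: $\mathbb{N}=\{0,1,2,\ldots\}$. For $P,Q\in\mathbb{Z}$, the Lucas sequence $U_n=U_n(P,Q)$ is defined by $U_0=0$, $U_1=1$, $U_{n+2}=PU_{n+1}-QU_n$. For $R\in\mathbb{Q}$, $\mathcal{L}(P,Q,R)=\{n\in\mathbb{N} : U_nR\in\mathbb{Z}\}$. $\nu_p$ is the $p$-adic valuation ($\nu_p(0)=\infty$). $\langle m\rangle=m\mathbb{N}$. For $m\geq1$, $S_m=\{0,m,m+1,\ldots\}$. Let $U'_n=U_n(P',Q')$; $\rho'\geq 2$ denotes the rank of appearance of $p$ in $U'_n$, i.e., the least $\rho'\geq 2$ with $p\mid U'_{\rho'}$ (it exists since $p\nmid Q'$), and $\nu'=\nu_p(U'_{\rho'})$. -}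

module Defs where

open import Data.Nat as ℕ using (ℕ; zero; suc; _^_; _≤_; _∸_; NonZero)
open import Data.Nat.Properties using (m^n≢0)
open import Data.Nat.DivMod using (_/_)
open import Data.Nat.Divisibility as ℕD using ()
open import Data.Nat.Primality using (Prime; prime⇒nonZero)
open import Data.Integer as ℤ using (ℤ; +_)
open import Data.Integer.Divisibility as ℤD using ()
open import Data.Rational as ℚ using (ℚ)
open import Data.Product using (Σ; _×_; ∃)
open import Data.Sum using (_⊎_)
open import Data.Empty using (⊥)
open import Data.Unit using (⊤)
open import Relation.Binary.PropositionalEquality using (_≡_; _≢_)
open import Relation.Nullary using (¬_)

U : ℤ → ℤ → ℕ → ℤ
U P Q zero = + 0
U P Q (suc zero) = + 1
U P Q (suc (suc n)) = P ℤ.* U P Q (suc n) ℤ.- Q ℤ.* U P Q n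

IsInt : ℚ → Set
IsInt q = Σ ℤ λ z → q ≡ z ℚ./ 1

InL : ℤ → ℤ → ℚ → ℕ → Set
InL P Q R n = IsInt (U P Q n ℚ./ 1 ℚ.* R)

pInv : (p : ℕ) → Prime p → ℕ → ℚ
pInv p pp r = (+ 1) ℚ./ (p ^ r)
  where instance
    _ = prime⇒nonZero pp
    _ = m^n≢0 p r

InS : ℕ → ℕ → Set
InS m n = (n ≡ 0) ⊎ (m ≤ n)

ceilDiv : ℕ → (a : ℕ) → .{{NonZero a}} → ℕ
ceilDiv x a = (x ℕ.+ a ∸ 1) / a

data ℕ∞ : Set where
  fin : ℕ → ℕ∞
  ∞   : ℕ∞

-- IsVal p x v : v = ν_p(x)  (with ν_p(0) = ∞)
IsVal : ℕ → ℤ → ℕ∞ → Set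
IsVal p x (fin k) = (x ≢ + 0) × ((+ (p ^ k)) ℤD.∣ x) × ¬ ((+ (p ^ suc k)) ℤD.∣ x)
IsVal p x ∞ = x ≡ + 0

-- ν_p(m) ≥ t for m ∈ ℕ and t ∈ ℤ  (every k ≤ t has p^k ∣ m; so ν_p(0) = ∞ ≥ t)
ValGE : ℕ → ℕ → ℤ → Set
ValGE p m t = (k : ℕ) → (+ k) ℤ.≤ t → (p ^ k) ℕD.∣ m

-- ν_p(m) ≥ t - w  where w ∈ ℕ ∪ {∞}  (t - ∞ = -∞)
ValGE∞ : ℕ → ℕ → ℤ → ℕ∞ → Set
ValGE∞ p m t (fin w) = ValGE p m (t ℤ.- (+ w))
ValGE∞ p m t ∞ = ⊤

IsRank : ℕ → ℤ → ℤ → ℕ → Set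
IsRank p P Q ρ = (2 ≤ ρ) × ((+ p) ℤD.∣ U P Q ρ)
               × ((k : ℕ) → 2 ≤ k → k ℕ.< ρ → ¬ ((+ p) ℤD.∣ U P Q k))

-- Since P = p^a P' and Q = p^(2a) Q', scaling gives U_(n+1)(P, Q) = p^(an) U'_(n+1), so p^r ∣ U_(n+1)
-- exactly when r ≤ an (that is, n + 1 ∈ S_⌈(r+a)/a⌉) or p^(r - an) ∣ U'_(n+1).  In the latter case
-- p ∣ U'_(n+1), which forces ρ' ∣ n + 1, say n + 1 = m ρ'.  As p is odd and prime to Q', the valuation
-- lifts along multiples of the rank: ν_p(U'_(m ρ')) = ν' + ν_p(m).  This comes from the congruence
-- 2^(k-1) U_(kn) ≡ k V_n^(k-1) U_n modulo U_n^3, which raises the valuation by exactly one when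
-- k = p and keeps it when p ∤ k.

module Submission where

open import Defs
open import Data.Nat as ℕ using (ℕ; zero; suc; _≤_; _^_; NonZero; nonTrivial⇒n>1)
import Data.Nat.Properties as ℕP
open import Data.Nat.Divisibility as ℕD using ()
open import Data.Nat.DivMod using (_%_; _/_; m≡m%n+[m/n]*n; m%n<n; m<n*o⇒m/o<n)
open import Data.Nat.Induction using (<-wellFounded)
open import Data.Nat.Primality using (Prime; prime⇒nonZero; prime⇒nonTrivial; euclidsLemma)
import Data.Nat.Tactic.RingSolver as ℕ-Ring
open import Data.Integer as ℤ using (ℤ; +_; ∣_∣)
import Data.Integer.Properties as ℤP
open import Data.Integer.Divisibility as ℤD using ()
import Data.Integer.Divisibility.Signed as ℤ∣
open import Data.Integer.Tactic.RingSolver using (solve-∀)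
open import Data.Product using (Σ; _×_; _,_)
open import Data.Sum using (_⊎_; inj₁; inj₂; [_,_]′)
open import Data.Unit using (⊤; tt)
open import Function using (id; _∘_; _⇔_; mk⇔; Equivalence)
open import Function.Construct.Symmetry using (⇔-sym)
import Function.Related.Propositional as Related
open import Induction.WellFounded using (Acc; acc)
open import Relation.Binary.PropositionalEquality
  using (_≡_; _≢_; refl; sym; trans; cong; cong₂; subst; subst₂; module ≡-Reasoning)
open import Relation.Nullary using (¬_; yes; no; contradiction)

nonZero-factor : ∀ {n} m {ρ} → .{{NonZero n}} → n ≡ m ℕ.* ρ → NonZero m
nonZero-factor zero n≡0 = contradiction n≡0 (ℕ.≢-nonZero⁻¹ _)
nonZero-factor (suc m) _ = _

m≤n⇒x^m∣x^n : ∀ x {m n} → m ≤ n → x ^ m ℕD.∣ x ^ n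
m≤n⇒x^m∣x^n x {m} {n} m≤n with ℕP.m≤n⇒∃[o]m+o≡n m≤n
... | o , refl = ℕD.divides (x ^ o) (trans (ℕP.^-distribˡ-+-* x m o) (ℕP.*-comm (x ^ m) (x ^ o)))

x^m∣x^n*y⇔x^[m∸n]∣y : ∀ x m n y .{{_ : NonZero x}} → x ^ m ℕD.∣ x ^ n ℕ.* y ⇔ x ^ (m ℕ.∸ n) ℕD.∣ y
x^m∣x^n*y⇔x^[m∸n]∣y x m n y with m ℕ.≤? n
... | yes m≤n = mk⇔
  (λ _ → subst (ℕD._∣ y) (cong (x ^_) (sym (ℕP.m≤n⇒m∸n≡0 m≤n))) (ℕD.1∣ y))
  (λ _ → ℕD.∣m⇒∣m*n y (m≤n⇒x^m∣x^n x m≤n))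
... | no m≰n = mk⇔
  (λ x^m∣x^n*y → ℕD.*-cancelˡ-∣ (x ^ n) {{ℕP.m^n≢0 x n}} (subst (ℕD._∣ x ^ n ℕ.* y) x^m≡x^n*x^[m∸n] x^m∣x^n*y))
  (λ x^[m∸n]∣y → subst (ℕD._∣ x ^ n ℕ.* y) (sym x^m≡x^n*x^[m∸n]) (ℕD.*-monoʳ-∣ (x ^ n) x^[m∸n]∣y))
  where
  x^m≡x^n*x^[m∸n] : x ^ m ≡ x ^ n ℕ.* x ^ (m ℕ.∸ n)
  x^m≡x^n*x^[m∸n] = trans (cong (x ^_) (sym (ℕP.m+[n∸m]≡n (ℕP.<⇒≤ (ℕP.≰⇒> m≰n))))) (ℕP.^-distribˡ-+-* x n (m ℕ.∸ n))

ceilDiv≤⇔≤* : ∀ x a k .{{_ : NonZero a}} → ceilDiv x a ≤ k ⇔ x ≤ k ℕ.* a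
ceilDiv≤⇔≤* x a@(suc a-1) k = mk⇔ to from
  where
  X≡x+a-1 : x ℕ.+ a ℕ.∸ 1 ≡ x ℕ.+ a-1
  X≡x+a-1 = cong (ℕ._∸ 1) (ℕP.+-suc x a-1)
  to : ceilDiv x a ≤ k → x ≤ k ℕ.* a
  to X/a≤k = ℕP.+-cancelʳ-≤ a-1 x (k ℕ.* a) (ℕP.≤-pred (begin
    suc (x ℕ.+ a-1)                                             ≡⟨ cong suc (sym X≡x+a-1) ⟩
    suc (x ℕ.+ a ℕ.∸ 1)                                         ≡⟨ cong suc (m≡m%n+[m/n]*n (x ℕ.+ a ℕ.∸ 1) a) ⟩
    suc ((x ℕ.+ a ℕ.∸ 1) % a ℕ.+ ceilDiv x a ℕ.* a)             ≤⟨ ℕP.+-mono-≤ (m%n<n (x ℕ.+ a ℕ.∸ 1) a) (ℕP.*-monoˡ-≤ a X/a≤k) ⟩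
    a ℕ.+ k ℕ.* a                                               ≡⟨ ℕP.+-comm a (k ℕ.* a) ⟩
    k ℕ.* a ℕ.+ a                                               ≡⟨ ℕP.+-suc (k ℕ.* a) a-1 ⟩
    suc (k ℕ.* a ℕ.+ a-1)                                       ∎))
    where open ℕP.≤-Reasoning
  from : x ≤ k ℕ.* a → ceilDiv x a ≤ k
  from x≤k*a = ℕP.≤-pred (m<n*o⇒m/o<n (begin-strict
    x ℕ.+ a ℕ.∸ 1     ≡⟨ X≡x+a-1 ⟩
    x ℕ.+ a-1         ≤⟨ ℕP.+-monoˡ-≤ a-1 x≤k*a ⟩
    k ℕ.* a ℕ.+ a-1   ≡⟨ ℕP.+-comm (k ℕ.* a) a-1 ⟩
    a-1 ℕ.+ k ℕ.* a   <⟨ ℕP.n<1+n _ ⟩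
    suc k ℕ.* a       ∎))
    where open ℕP.≤-Reasoning

+m-+n≤+o⇔m≤n+o : ∀ m n o → + m ℤ.- + n ℤ.≤ + o ⇔ m ≤ n ℕ.+ o
+m-+n≤+o⇔m≤n+o m n o = mk⇔
  (λ m-n≤o → ℤP.drop‿+≤+ (ℤP.i-j≤0⇒i≤j (subst (ℤ._≤ + 0) (reassoc (+ m) (+ n) (+ o)) (ℤP.i≤j⇒i-j≤0 m-n≤o))))
  (λ m≤n+o → ℤP.i-j≤0⇒i≤j (subst (ℤ._≤ + 0) (sym (reassoc (+ m) (+ n) (+ o))) (ℤP.i≤j⇒i-j≤0 (ℤ.+≤+ m≤n+o))))
  where
  reassoc : ∀ a b c → a ℤ.- b ℤ.- c ≡ a ℤ.- (b ℤ.+ c)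
  reassoc = solve-∀

+r++a-+[a*[1+n]]≡+[r∸a*n] : ∀ r a n → a ℕ.* n ≤ r → + r ℤ.+ + a ℤ.- + (a ℕ.* suc n) ≡ + (r ℕ.∸ a ℕ.* n)
+r++a-+[a*[1+n]]≡+[r∸a*n] r a n a*n≤r = begin
  + r ℤ.+ + a ℤ.- + (a ℕ.* suc n)     ≡⟨ cong (λ m → + r ℤ.+ + a ℤ.- + m) (ℕP.*-suc a n) ⟩
  + r ℤ.+ + a ℤ.- (+ a ℤ.+ + (a ℕ.* n)) ≡⟨ cancel (+ r) (+ a) (+ (a ℕ.* n)) ⟩
  + r ℤ.- + (a ℕ.* n)                 ≡⟨ ℤP.m-n≡m⊖n r (a ℕ.* n) ⟩
  r ℤ.⊖ a ℕ.* n                       ≡⟨ ℤP.⊖-≥ a*n≤r ⟩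
  + (r ℕ.∸ a ℕ.* n)                   ∎
  where
  open ≡-Reasoning
  cancel : ∀ r a b → r ℤ.+ a ℤ.- (a ℤ.+ b) ≡ r ℤ.- b
  cancel = solve-∀

∣+c^n∣≡c^n : ∀ c n → ∣ (+ c) ℤ.^ n ∣ ≡ c ^ n
∣+c^n∣≡c^n c zero = refl
∣+c^n∣≡c^n c (suc n) = trans (ℤP.abs-* (+ c) ((+ c) ℤ.^ n)) (cong (c ℕ.*_) (∣+c^n∣≡c^n c n))

fromℕ∣ : ∀ {d} x → d ℕD.∣ ∣ x ∣ → + d ℤ∣.∣ x
fromℕ∣ {d} x = ℤ∣.∣ᵤ⇒∣ {+ d} {x}

toℕ∣ : ∀ {d} x → + d ℤ∣.∣ x → d ℕD.∣ ∣ x ∣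
toℕ∣ {d} x = ℤ∣.∣⇒∣ᵤ {+ d} {x}

∣X-Y⇒∣X⇔∣Y : ∀ {d} X Y → + d ℤ∣.∣ X ℤ.- Y → d ℕD.∣ ∣ X ∣ ⇔ d ℕD.∣ ∣ Y ∣
∣X-Y⇒∣X⇔∣Y {d} X Y d∣X-Y = mk⇔
  (λ d∣X → toℕ∣ Y (ℤ∣.∣m+n∣m⇒∣n (subst (+ d ℤ∣.∣_) (X≡X-Y+Y X Y) (fromℕ∣ X d∣X)) d∣X-Y))
  (λ d∣Y → toℕ∣ X (subst (+ d ℤ∣.∣_) (sym (X≡X-Y+Y X Y)) (ℤ∣.∣m∣n⇒∣m+n d∣X-Y (fromℕ∣ Y d∣Y))))
  where
  X≡X-Y+Y : ∀ X Y → X ≡ (X ℤ.- Y) ℤ.+ Y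
  X≡X-Y+Y = solve-∀

module _ where
  open import Data.Rational as ℚ using (toℚᵘ)
  import Data.Rational.Properties as ℚP
  open import Data.Rational.Unnormalised as ℚᵘ using (mkℚᵘ; *≡*)
  import Data.Rational.Unnormalised.Properties as ℚᵘP

  toℚᵘ-/ : ∀ i d .{{_ : NonZero d}} → toℚᵘ (i ℚ./ d) ℚᵘ.≃ mkℚᵘ i (ℕ.pred d)
  toℚᵘ-/ i (suc d) = ℚP.toℚᵘ-fromℚᵘ (mkℚᵘ i d)

  toℚᵘ-x/1*1/d : ∀ x d .{{_ : NonZero d}} → toℚᵘ ((x ℚ./ 1) ℚ.* ((+ 1) ℚ./ d)) ℚᵘ.≃ mkℚᵘ x 0 ℚᵘ.* mkℚᵘ (+ 1) (ℕ.pred d)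
  toℚᵘ-x/1*1/d x d = ℚᵘP.≃-trans (ℚP.toℚᵘ-homo-* (x ℚ./ 1) ((+ 1) ℚ./ d)) (ℚᵘP.*-cong (toℚᵘ-/ x 1) (toℚᵘ-/ (+ 1) d))

  IsInt[x/1*1/d]⇔d∣x : ∀ x d .{{_ : NonZero d}} → IsInt ((x ℚ./ 1) ℚ.* ((+ 1) ℚ./ d)) ⇔ d ℕD.∣ ∣ x ∣
  IsInt[x/1*1/d]⇔d∣x x d@(suc d-1) = mk⇔ to from
    where
    x*1*1≡x : x ℤ.* + 1 ℤ.* + 1 ≡ x
    x*1*1≡x = trans (ℤP.*-identityʳ _) (ℤP.*-identityʳ x)
    to : IsInt ((x ℚ./ 1) ℚ.* ((+ 1) ℚ./ d)) → d ℕD.∣ ∣ x ∣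
    to (z , x/d≡z) = toℕ∣ x (ℤ∣.divides z (trans (sym x*1*1≡x) (trans (ℚᵘP.drop-*≡* x/d≃z) (cong (z ℤ.*_) (ℤP.*-identityˡ _)))))
      where
      x/d≃z : mkℚᵘ x 0 ℚᵘ.* mkℚᵘ (+ 1) d-1 ℚᵘ.≃ mkℚᵘ z 0
      x/d≃z = ℚᵘP.≃-trans (ℚᵘP.≃-sym (toℚᵘ-x/1*1/d x d)) (ℚᵘP.≃-trans (ℚP.toℚᵘ-cong x/d≡z) (toℚᵘ-/ z 1))
    from : d ℕD.∣ ∣ x ∣ → IsInt ((x ℚ./ 1) ℚ.* ((+ 1) ℚ./ d))
    from d∣x with fromℕ∣ x d∣x
    ... | ℤ∣.divides z x≡z*d = z , ℚP.toℚᵘ-injective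
      (ℚᵘP.≃-trans (toℚᵘ-x/1*1/d x d) (ℚᵘP.≃-trans (*≡* cross) (ℚᵘP.≃-sym (toℚᵘ-/ z 1))))
      where
      cross : x ℤ.* + 1 ℤ.* + 1 ≡ z ℤ.* (+ 1 ℤ.* + d)
      cross = trans x*1*1≡x (trans x≡z*d (cong (z ℤ.*_) (sym (ℤP.*-identityˡ _))))

module PrimePowers {p : ℕ} (p-prime : Prime p) where
  open import Data.Nat.Divisibility
    using (_∣_; divides; ∣-trans; ∣m⇒∣m*n; ∣n⇒∣m*n; *-monoʳ-∣; *-cancelˡ-∣; m*n∣⇒m∣)

  instance
    p≢0 : NonZero p
    p≢0 = prime⇒nonZero p-prime

  p>1 : 1 ℕ.< p
  p>1 = nonTrivial⇒n>1 p {{prime⇒nonTrivial p-prime}}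

  p∤1 : ¬ p ∣ 1
  p∤1 p∣1 = ℕP.<⇒≢ p>1 (sym (ℕD.∣1⇒≡1 p∣1))

  infix 4 p^_∥_
  record p^_∥_ (j x : ℕ) : Set where
    constructor exactly
    field
      ∥⇒∣ : p ^ j ∣ x
      ∥⇒∤ : ¬ p ^ suc j ∣ x
  open p^_∥_ public

  p∤-* : ∀ {u x} → ¬ p ∣ u → ¬ p ∣ x → ¬ p ∣ u ℕ.* x
  p∤-* {u} {x} p∤u p∤x p∣ux = [ p∤u , p∤x ]′ (euclidsLemma u x p-prime p∣ux)

  p∤u⇒p^j∣u*x⇒p^j∣x : ∀ j {u x} → ¬ p ∣ u → p ^ j ∣ u ℕ.* x → p ^ j ∣ x
  p∤u⇒p^j∣u*x⇒p^j∣x zero {x = x} _ _ = ℕD.1∣ x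
  p∤u⇒p^j∣u*x⇒p^j∣x (suc j) {u} {x} p∤u p^j+1∣ux with euclidsLemma u x p-prime (m*n∣⇒m∣ p (p ^ j) p^j+1∣ux)
  ... | inj₁ p∣u = contradiction p∣u p∤u
  ... | inj₂ (divides q refl) = subst (p ℕ.* p ^ j ∣_) (ℕP.*-comm p q) (*-monoʳ-∣ p p^j∣q)
    where
    p^j∣q : p ^ j ∣ q
    p^j∣q = p∤u⇒p^j∣u*x⇒p^j∣x j p∤u (*-cancelˡ-∣ p
      (subst (p ℕ.* p ^ j ∣_) (trans (sym (ℕP.*-assoc u q p)) (ℕP.*-comm (u ℕ.* q) p)) p^j+1∣ux))

  ∥-*ˡ : ∀ {j u x} → ¬ p ∣ u → p^ j ∥ x → p^ j ∥ u ℕ.* x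
  ∥-*ˡ {j} {u} p∤u (exactly p^j∣x p^j+1∤x) = exactly (∣n⇒∣m*n u p^j∣x) (p^j+1∤x ∘ p∤u⇒p^j∣u*x⇒p^j∣x (suc j) p∤u)

  ∥-cancelˡ : ∀ {j u x} → ¬ p ∣ u → p^ j ∥ u ℕ.* x → p^ j ∥ x
  ∥-cancelˡ {j} {u} p∤u (exactly p^j∣ux p^j+1∤ux) = exactly (p∤u⇒p^j∣u*x⇒p^j∣x j p∤u p^j∣ux) (p^j+1∤ux ∘ ∣n⇒∣m*n u)

  ∥-p* : ∀ {j x} → p^ j ∥ x → p^ suc j ∥ p ℕ.* x
  ∥-p* (exactly p^j∣x p^j+1∤x) = exactly (*-monoʳ-∣ p p^j∣x) (p^j+1∤x ∘ *-cancelˡ-∣ p)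

  p^e∥p^e*m : ∀ e {m} → ¬ p ∣ m → p^ e ∥ p ^ e ℕ.* m
  p^e∥p^e*m zero {m} p∤m = exactly (ℕD.1∣ _) (p∤m ∘ subst₂ _∣_ (ℕP.*-identityʳ p) (ℕP.*-identityˡ m))
  p^e∥p^e*m (suc e) {m} p∤m = subst (p^ suc e ∥_) (sym (ℕP.*-assoc p (p ^ e) m)) (∥-p* (p^e∥p^e*m e p∤m))

  p^j∥x⇒p^k∣x⇔k≤j : ∀ {j x k} → p^ j ∥ x → p ^ k ∣ x ⇔ k ≤ j
  p^j∥x⇒p^k∣x⇔k≤j {j} {x} {k} (exactly p^j∣x p^j+1∤x) = mk⇔ k≤j (λ k≤j → ∣-trans (m≤n⇒x^m∣x^n p k≤j) p^j∣x)
    where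
    k≤j : p ^ k ∣ x → k ≤ j
    k≤j p^k∣x with k ℕ.≤? j
    ... | yes k≤j = k≤j
    ... | no k≰j = contradiction (∣-trans (m≤n⇒x^m∣x^n p (ℕP.≰⇒> k≰j)) p^k∣x) p^j+1∤x

  p-adic-decomposition : ∀ m → .{{NonZero m}} → Σ ℕ λ e → Σ ℕ λ m' → ¬ p ∣ m' × m ≡ p ^ e ℕ.* m'
  p-adic-decomposition m = go m (<-wellFounded m)
    where
    go : ∀ m → .{{NonZero m}} → Acc ℕ._<_ m → Σ ℕ λ e → Σ ℕ λ m' → ¬ p ∣ m' × m ≡ p ^ e ℕ.* m'
    go m (acc smaller) with p ℕD.∣? m
    ... | no p∤m = 0 , m , p∤m , sym (ℕP.*-identityˡ m)
    ... | yes (divides q refl) with go q {{ℕP.m*n≢0⇒m≢0 q}} (smaller (ℕP.m<m*n q p {{ℕP.m*n≢0⇒m≢0 q}} p>1))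
    ... | e , m' , p∤m' , q≡p^e*m' =
      suc e , m' , p∤m' , trans (cong (ℕ._* p) q≡p^e*m') (trans (ℕP.*-comm (p ^ e ℕ.* m') p) (sym (ℕP.*-assoc p (p ^ e) m')))

  p^e∥m⇒ValGE⇔≤ : ∀ {e m t} → p^ e ∥ m → ValGE p m t ⇔ t ℤ.≤ + e
  p^e∥m⇒ValGE⇔≤ {e} {m} {t} p^e∥m =
    mk⇔ t≤e (λ t≤e k k≤t → Equivalence.from (p^j∥x⇒p^k∣x⇔k≤j p^e∥m) (ℤP.drop‿+≤+ (ℤP.≤-trans k≤t t≤e)))
    where
    t≤e : ∀ {t} → ValGE p m t → t ℤ.≤ + e
    t≤e {+ k} valGE = ℤ.+≤+ (Equivalence.to (p^j∥x⇒p^k∣x⇔k≤j p^e∥m) (valGE k ℤP.≤-refl))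
    t≤e {ℤ.-[1+ _ ]} _ = ℤ.-≤+

  ∥-congruent : ∀ {j} X Y → + (p ^ suc j) ℤ∣.∣ X ℤ.- Y → p^ j ∥ ∣ Y ∣ → p^ j ∥ ∣ X ∣
  ∥-congruent {j} X Y p^j+1∣X-Y (exactly p^j∣Y p^j+1∤Y) = exactly
    (Equivalence.from (∣X-Y⇒∣X⇔∣Y X Y p^j∣X-Y) p^j∣Y)
    (p^j+1∤Y ∘ Equivalence.to (∣X-Y⇒∣X⇔∣Y X Y p^j+1∣X-Y))
    where
    p^j∣X-Y : + (p ^ j) ℤ∣.∣ X ℤ.- Y
    p^j∣X-Y = ℤ∣.∣-trans (fromℕ∣ (+ (p ^ suc j)) (ℕD.n∣m*n p)) p^j+1∣X-Y

  p∤∣*∣ : ∀ x y → ¬ p ∣ ∣ x ∣ → ¬ p ∣ ∣ y ∣ → ¬ p ∣ ∣ x ℤ.* y ∣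
  p∤∣*∣ x y p∤x p∤y = p∤-* p∤x p∤y ∘ subst (p ∣_) (ℤP.abs-* x y)

  p∤∣^∣ : ∀ x k → ¬ p ∣ ∣ x ∣ → ¬ p ∣ ∣ x ℤ.^ k ∣
  p∤∣^∣ x zero _ = p∤1
  p∤∣^∣ x (suc k) p∤x = p∤∣*∣ x (x ℤ.^ k) p∤x (p∤∣^∣ x k p∤x)

  p∤∣x∣⇒p∣∣x*y∣⇒p∣∣y∣ : ∀ x y → ¬ p ∣ ∣ x ∣ → p ∣ ∣ x ℤ.* y ∣ → p ∣ ∣ y ∣
  p∤∣x∣⇒p∣∣x*y∣⇒p∣∣y∣ x y p∤x p∣xy with euclidsLemma ∣ x ∣ ∣ y ∣ p-prime (subst (p ∣_) (ℤP.abs-* x y) p∣xy)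
  ... | inj₁ p∣x = contradiction p∣x p∤x
  ... | inj₂ p∣y = p∣y

-- The companion Lucas sequence V_n = U_(n+1) - Q U_(n-1).
V : ℤ → ℤ → ℕ → ℤ
V P Q n = + 2 ℤ.* U P Q (suc n) ℤ.- P ℤ.* U P Q n

module LucasIdentities (P Q : ℤ) where
  open import Data.Integer using (_+_; _-_; _*_)
  open import Data.Integer.Divisibility.Signed
    using (_∣_; divides; ∣-refl; ∣m∣n⇒∣m+n; ∣m∣n⇒∣m-n; ∣m⇒∣m*n; ∣n⇒∣m*n; *-monoʳ-∣)
  open ≡-Reasoning

  U-+ : ∀ m s → U P Q (m ℕ.+ suc s) ≡ U P Q (suc m) * U P Q (suc s) - Q * U P Q m * U P Q s
  U-+ zero s = ring Q (U P Q (suc s)) (U P Q s)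
    where
    ring : ∀ Q x y → x ≡ + 1 * x - Q * + 0 * y
    ring = solve-∀
  U-+ (suc zero) s = ring P Q (U P Q (suc s)) (U P Q s)
    where
    ring : ∀ P Q x y → P * x - Q * y ≡ (P * + 1 - Q * + 0) * x - Q * + 1 * y
    ring = solve-∀
  U-+ (suc (suc m)) s = begin
    P * U P Q (suc m ℕ.+ suc s) - Q * U P Q (m ℕ.+ suc s)
      ≡⟨ cong₂ (λ x y → P * x - Q * y) (U-+ (suc m) s) (U-+ m s) ⟩
    P * (U P Q (suc (suc m)) * U P Q (suc s) - Q * U P Q (suc m) * U P Q s)
      - Q * (U P Q (suc m) * U P Q (suc s) - Q * U P Q m * U P Q s)
      ≡⟨ ring P Q (U P Q (suc m)) (U P Q m) (U P Q (suc s)) (U P Q s) ⟩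
    U P Q (suc (suc (suc m))) * U P Q (suc s) - Q * U P Q (suc (suc m)) * U P Q s ∎
    where
    ring : ∀ P Q x y c d → P * ((P * x - Q * y) * c - Q * x * d) - Q * (x * c - Q * y * d)
                         ≡ (P * (P * x - Q * y) - Q * x) * c - Q * (P * x - Q * y) * d
    ring = solve-∀

  module Multiples (s : ℕ) where
    n : ℕ
    n = suc s

    Δ : ℤ
    Δ = P * P - + 4 * Q

    U[kn+n] : ∀ k → U P Q (suc k ℕ.* n) ≡ U P Q (suc (k ℕ.* n)) * U P Q n - Q * U P Q (k ℕ.* n) * U P Q s
    U[kn+n] k = trans (cong (U P Q) (ℕP.+-comm n (k ℕ.* n))) (U-+ (k ℕ.* n) s)

    U[kn+n+1] : ∀ k → U P Q (suc (suc k ℕ.* n))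
              ≡ (P * U P Q (suc (k ℕ.* n)) - Q * U P Q (k ℕ.* n)) * U P Q n - Q * U P Q (suc (k ℕ.* n)) * U P Q s
    U[kn+n+1] k = trans (cong (λ m → U P Q (suc m)) (ℕP.+-comm n (k ℕ.* n))) (U-+ (suc (k ℕ.* n)) s)

    2U[kn+n] : ∀ k → + 2 * U P Q (suc k ℕ.* n) ≡ V P Q (k ℕ.* n) * U P Q n + U P Q (k ℕ.* n) * V P Q n
    2U[kn+n] k = trans (cong (+ 2 *_) (U[kn+n] k)) (ring P Q (U P Q (suc (k ℕ.* n))) (U P Q (k ℕ.* n)) (U P Q n) (U P Q s))
      where
      ring : ∀ P Q c a w g → + 2 * (c * w - Q * a * g) ≡ (+ 2 * c - P * a) * w + a * (+ 2 * (P * w - Q * g) - P * w)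
      ring = solve-∀

    2V[kn+n] : ∀ k → + 2 * V P Q (suc k ℕ.* n) ≡ V P Q (k ℕ.* n) * V P Q n + Δ * U P Q n * U P Q (k ℕ.* n)
    2V[kn+n] k = trans (cong₂ (λ c a → + 2 * (+ 2 * c - P * a)) (U[kn+n+1] k) (U[kn+n] k))
      (ring P Q (U P Q (suc (k ℕ.* n))) (U P Q (k ℕ.* n)) (U P Q n) (U P Q s))
      where
      ring : ∀ P Q c a w g → + 2 * (+ 2 * ((P * c - Q * a) * w - Q * c * g) - P * (c * w - Q * a * g))
                           ≡ (+ 2 * c - P * a) * (+ 2 * (P * w - Q * g) - P * w) + (P * P - + 4 * Q) * w * a
      ring = solve-∀

    U∣U-* : ∀ k → U P Q n ∣ U P Q (k ℕ.* n)
    U∣U-* zero = divides (+ 0) refl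
    U∣U-* (suc k) = subst (U P Q n ∣_) (sym (U[kn+n] k))
      (∣m∣n⇒∣m-n (∣n⇒∣m*n (U P Q (suc (k ℕ.* n))) ∣-refl) (∣m⇒∣m*n (U P Q s) (∣n⇒∣m*n Q (U∣U-* k))))

    -- 2^(k-1) V_(kn) ≡ V_n^k modulo U_n^2, doubled so that k = 0 is included.
    V-*-congruence : ∀ k → U P Q n * U P Q n ∣ (+ 2) ℤ.^ k * V P Q (k ℕ.* n) - + 2 * V P Q n ℤ.^ k
    V-*-congruence zero = divides (+ 0) (ring P (U P Q n))
      where
      ring : ∀ P w → + 1 * (+ 2 * + 1 - P * + 0) - + 2 * + 1 ≡ + 0 * (w * w)
      ring = solve-∀
    V-*-congruence (suc k) with U∣U-* k
    ... | divides q Uₖₙ≡q*Uₙ = subst (U P Q n * U P Q n ∣_) (sym expand)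
      (∣m∣n⇒∣m+n (∣n⇒∣m*n (V P Q n) (V-*-congruence k)) (∣n⇒∣m*n ((+ 2) ℤ.^ k * Δ * q) ∣-refl))
      where
      T = (+ 2) ℤ.^ k
      Vₙ = V P Q n
      Uₙ = U P Q n
      expand : + 2 * T * V P Q (suc k ℕ.* n) - + 2 * (Vₙ * Vₙ ℤ.^ k)
             ≡ Vₙ * (T * V P Q (k ℕ.* n) - + 2 * Vₙ ℤ.^ k) + (T * Δ * q) * (Uₙ * Uₙ)
      expand = begin
        + 2 * T * V P Q (suc k ℕ.* n) - + 2 * (Vₙ * Vₙ ℤ.^ k)
          ≡⟨ cong (_- + 2 * (Vₙ * Vₙ ℤ.^ k)) (swap T (V P Q (suc k ℕ.* n))) ⟩
        T * (+ 2 * V P Q (suc k ℕ.* n)) - + 2 * (Vₙ * Vₙ ℤ.^ k)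
          ≡⟨ cong (λ x → T * x - + 2 * (Vₙ * Vₙ ℤ.^ k)) (2V[kn+n] k) ⟩
        T * (V P Q (k ℕ.* n) * Vₙ + Δ * Uₙ * U P Q (k ℕ.* n)) - + 2 * (Vₙ * Vₙ ℤ.^ k)
          ≡⟨ cong (λ a → T * (V P Q (k ℕ.* n) * Vₙ + Δ * Uₙ * a) - + 2 * (Vₙ * Vₙ ℤ.^ k)) Uₖₙ≡q*Uₙ ⟩
        T * (V P Q (k ℕ.* n) * Vₙ + Δ * Uₙ * (q * Uₙ)) - + 2 * (Vₙ * Vₙ ℤ.^ k)
          ≡⟨ ring T (V P Q (k ℕ.* n)) Vₙ (Vₙ ℤ.^ k) Δ Uₙ q ⟩
        Vₙ * (T * V P Q (k ℕ.* n) - + 2 * Vₙ ℤ.^ k) + (T * Δ * q) * (Uₙ * Uₙ) ∎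
        where
        swap : ∀ T X → + 2 * T * X ≡ T * (+ 2 * X)
        swap = solve-∀
        ring : ∀ T X V Vᵏ D w q → T * (X * V + D * w * (q * w)) - + 2 * (V * Vᵏ)
                                ≡ V * (T * X - + 2 * Vᵏ) + (T * D * q) * (w * w)
        ring = solve-∀

    -- 2^(k-1) U_(kn) ≡ k V_n^(k-1) U_n modulo U_n^3, doubled and stated for k + 1.
    U-*-congruence : ∀ k → U P Q n * (U P Q n * U P Q n)
                         ∣ (+ 2) ℤ.^ suc k * U P Q (suc k ℕ.* n) - + 2 * + suc k * V P Q n ℤ.^ k * U P Q n
    U-*-congruence zero = divides (+ 0) (begin
      + 2 * + 1 * U P Q (n ℕ.+ 0) - + 2 * + 1 * + 1 * U P Q n
        ≡⟨ cong (λ m → + 2 * + 1 * U P Q m - + 2 * + 1 * + 1 * U P Q n) (ℕP.+-identityʳ n) ⟩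
      + 2 * + 1 * U P Q n - + 2 * + 1 * + 1 * U P Q n
        ≡⟨ ring (U P Q n) ⟩
      + 0 * (U P Q n * (U P Q n * U P Q n)) ∎)
      where
      ring : ∀ w → + 2 * + 1 * w - + 2 * + 1 * + 1 * w ≡ + 0 * (w * (w * w))
      ring = solve-∀
    U-*-congruence (suc k) = subst (Uₙ * (Uₙ * Uₙ) ∣_) (sym expand)
      (∣m∣n⇒∣m+n (*-monoʳ-∣ Uₙ (V-*-congruence (suc k))) (∣n⇒∣m*n Vₙ (U-*-congruence k)))
      where
      T = (+ 2) ℤ.^ suc k
      Vₙ = V P Q n
      Uₙ = U P Q n
      expand : + 2 * T * U P Q (suc (suc k) ℕ.* n) - + 2 * (+ 1 + + suc k) * (Vₙ * Vₙ ℤ.^ k) * Uₙ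
             ≡ Uₙ * (T * V P Q (suc k ℕ.* n) - + 2 * Vₙ ℤ.^ suc k) + Vₙ * (T * U P Q (suc k ℕ.* n) - + 2 * + suc k * Vₙ ℤ.^ k * Uₙ)
      expand = begin
        + 2 * T * U P Q (suc (suc k) ℕ.* n) - + 2 * (+ 1 + + suc k) * (Vₙ * Vₙ ℤ.^ k) * Uₙ
          ≡⟨ cong (_- + 2 * (+ 1 + + suc k) * (Vₙ * Vₙ ℤ.^ k) * Uₙ) (swap T (U P Q (suc (suc k) ℕ.* n))) ⟩
        T * (+ 2 * U P Q (suc (suc k) ℕ.* n)) - + 2 * (+ 1 + + suc k) * (Vₙ * Vₙ ℤ.^ k) * Uₙ
          ≡⟨ cong (λ x → T * x - + 2 * (+ 1 + + suc k) * (Vₙ * Vₙ ℤ.^ k) * Uₙ) (2U[kn+n] (suc k)) ⟩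
        T * (V P Q (suc k ℕ.* n) * Uₙ + U P Q (suc k ℕ.* n) * Vₙ) - + 2 * (+ 1 + + suc k) * (Vₙ * Vₙ ℤ.^ k) * Uₙ
          ≡⟨ ring T (V P Q (suc k ℕ.* n)) Uₙ (U P Q (suc k ℕ.* n)) Vₙ (+ suc k) (Vₙ ℤ.^ k) ⟩
        Uₙ * (T * V P Q (suc k ℕ.* n) - + 2 * Vₙ ℤ.^ suc k) + Vₙ * (T * U P Q (suc k ℕ.* n) - + 2 * + suc k * Vₙ ℤ.^ k * Uₙ) ∎
        where
        swap : ∀ T X → + 2 * T * X ≡ T * (+ 2 * X)
        swap = solve-∀
        ring : ∀ T X w A V K Vᵏ → T * (X * w + A * V) - + 2 * (+ 1 + K) * (V * Vᵏ) * w
                                ≡ w * (T * X - + 2 * (V * Vᵏ)) + V * (T * A - + 2 * K * Vᵏ * w)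
        ring = solve-∀

module _ where
  open import Data.Integer using (_-_; _*_)
  open ≡-Reasoning

  U-scale : ∀ c P Q n → U (c * P) (c * c * Q) (suc n) ≡ c ℤ.^ n * U P Q (suc n)
  U-scale c P Q zero = refl
  U-scale c P Q (suc zero) = ring c P Q
    where
    ring : ∀ c P Q → c * P * + 1 - c * c * Q * + 0 ≡ (c * + 1) * (P * + 1 - Q * + 0)
    ring = solve-∀
  U-scale c P Q (suc (suc n)) = begin
    c * P * U (c * P) (c * c * Q) (suc (suc n)) - c * c * Q * U (c * P) (c * c * Q) (suc n)
      ≡⟨ cong₂ (λ x y → c * P * x - c * c * Q * y) (U-scale c P Q (suc n)) (U-scale c P Q n) ⟩
    c * P * (c ℤ.^ suc n * U P Q (suc (suc n))) - c * c * Q * (c ℤ.^ n * U P Q (suc n))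
      ≡⟨ ring c P Q (c ℤ.^ n) (U P Q (suc (suc n))) (U P Q (suc n)) ⟩
    c ℤ.^ suc (suc n) * U P Q (suc (suc (suc n))) ∎
    where
    ring : ∀ c P Q cⁿ x y → c * P * (c * cⁿ * x) - c * c * Q * (cⁿ * y) ≡ (c * (c * cⁿ)) * (P * x - Q * y)
    ring = solve-∀

module LucasModuloPrime {p : ℕ} (p-prime : Prime p) (P Q : ℤ) (p∤Q : ¬ p ℕD.∣ ∣ Q ∣) where
  open import Data.Nat.Divisibility using (_∣_; divides; _∣0)
  open PrimePowers p-prime
  open LucasIdentities P Q

  p∤U-consecutive : ∀ m → p ∣ ∣ U P Q m ∣ → ¬ p ∣ ∣ U P Q (suc m) ∣
  p∤U-consecutive zero _ = p∤1
  p∤U-consecutive (suc m) p∣Uₘ₊₁ p∣Uₘ₊₂ = p∤U-consecutive m p∣Uₘ p∣Uₘ₊₁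
    where
    p∣PUₘ₊₁ : p ∣ ∣ P ℤ.* U P Q (suc m) ∣
    p∣PUₘ₊₁ = toℕ∣ (P ℤ.* U P Q (suc m)) (ℤ∣.∣n⇒∣m*n P (fromℕ∣ (U P Q (suc m)) p∣Uₘ₊₁))
    p∣Uₘ : p ∣ ∣ U P Q m ∣
    p∣Uₘ = p∤∣x∣⇒p∣∣x*y∣⇒p∣∣y∣ Q (U P Q m) p∤Q
      (Equivalence.to (∣X-Y⇒∣X⇔∣Y (P ℤ.* U P Q (suc m)) (Q ℤ.* U P Q m) (fromℕ∣ (U P Q (suc (suc m))) p∣Uₘ₊₂)) p∣PUₘ₊₁)

  p∣U[m]⇒p∣U[m+k]⇒p∣U[k] : ∀ m k → p ∣ ∣ U P Q m ∣ → p ∣ ∣ U P Q (m ℕ.+ k) ∣ → p ∣ ∣ U P Q k ∣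
  p∣U[m]⇒p∣U[m+k]⇒p∣U[k] m zero _ _ = p ∣0
  p∣U[m]⇒p∣U[m+k]⇒p∣U[k] m (suc k) p∣Uₘ p∣Uₘ₊ₖ₊₁ =
    p∤∣x∣⇒p∣∣x*y∣⇒p∣∣y∣ (U P Q (suc m)) (U P Q (suc k)) (p∤U-consecutive m p∣Uₘ)
      (Equivalence.from (∣X-Y⇒∣X⇔∣Y X Y (subst (+ p ℤ∣.∣_) (U-+ m k) (fromℕ∣ (U P Q (m ℕ.+ suc k)) p∣Uₘ₊ₖ₊₁))) p∣Y)
    where
    X Y : ℤ
    X = U P Q (suc m) ℤ.* U P Q (suc k)
    Y = Q ℤ.* U P Q m ℤ.* U P Q k
    p∣Y : p ∣ ∣ Y ∣
    p∣Y = toℕ∣ Y (ℤ∣.∣m⇒∣m*n (U P Q k) (ℤ∣.∣n⇒∣m*n Q (fromℕ∣ (U P Q m) p∣Uₘ)))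

  p∤U-below-rank : ∀ {ρ k} → IsRank p P Q ρ → 1 ≤ k → k ℕ.< ρ → ¬ p ∣ ∣ U P Q k ∣
  p∤U-below-rank {k = suc zero} _ _ _ = p∤1
  p∤U-below-rank {k = suc (suc k)} (_ , _ , below) _ k<ρ = below (suc (suc k)) (ℕ.s≤s (ℕ.s≤s ℕ.z≤n)) k<ρ

  p∣U-multiple-of-rank : ∀ {ρ} → IsRank p P Q ρ → ∀ q → p ∣ ∣ U P Q (q ℕ.* ρ) ∣
  p∣U-multiple-of-rank {suc s} (_ , p∣Uρ , _) q =
    toℕ∣ (U P Q (q ℕ.* suc s)) (ℤ∣.∣-trans (fromℕ∣ (U P Q (suc s)) p∣Uρ) (Multiples.U∣U-* s q))

  rank-∣ : ∀ {ρ n} → IsRank p P Q ρ → p ∣ ∣ U P Q n ∣ → ρ ∣ n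
  rank-∣ {ρ} {n} rank@(ℕ.s≤s (ℕ.s≤s _) , _) p∣Uₙ with n % ρ | m≡m%n+[m/n]*n n ρ | m%n<n n ρ
  ... | zero | n≡q*ρ | _ = divides (n / ρ) n≡q*ρ
  ... | suc r | n≡r+q*ρ | r<ρ = contradiction p∣Uᵣ (p∤U-below-rank rank (ℕ.s≤s ℕ.z≤n) r<ρ)
    where
    p∣Uᵣ : p ∣ ∣ U P Q (suc r) ∣
    p∣Uᵣ = p∣U[m]⇒p∣U[m+k]⇒p∣U[k] (n / ρ ℕ.* ρ) (suc r) (p∣U-multiple-of-rank rank (n / ρ))
      (subst (λ m → p ∣ ∣ U P Q m ∣) (trans n≡r+q*ρ (ℕP.+-comm (suc r) (n / ρ ℕ.* ρ))) p∣Uₙ)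

  module _ (p∤2 : ¬ p ∣ 2) where

    module MultiplesValuation (s μ : ℕ) (Uₙ-∥ : p^ suc μ ∥ ∣ U P Q (suc s) ∣) where
      open Multiples s

      p∣Uₙ : p ∣ ∣ U P Q n ∣
      p∣Uₙ = ℕD.m*n∣⇒m∣ p (p ^ μ) (∥⇒∣ Uₙ-∥)

      p∤Vₙ : ¬ p ∣ ∣ V P Q n ∣
      p∤Vₙ p∣Vₙ = p∤U-consecutive s p∣Uₛ p∣Uₙ
        where
        Vₙ≡PUₙ-2QUₛ : ∀ P Q w g → + 2 ℤ.* (P ℤ.* w ℤ.- Q ℤ.* g) ℤ.- P ℤ.* w ≡ P ℤ.* w ℤ.- + 2 ℤ.* Q ℤ.* g
        Vₙ≡PUₙ-2QUₛ = solve-∀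
        p∣2QUₛ : p ∣ ∣ + 2 ℤ.* Q ℤ.* U P Q s ∣
        p∣2QUₛ = Equivalence.to
          (∣X-Y⇒∣X⇔∣Y (P ℤ.* U P Q n) (+ 2 ℤ.* Q ℤ.* U P Q s)
            (subst (+ p ℤ∣.∣_) (Vₙ≡PUₙ-2QUₛ P Q (U P Q n) (U P Q s)) (fromℕ∣ (V P Q n) p∣Vₙ)))
          (toℕ∣ (P ℤ.* U P Q n) (ℤ∣.∣n⇒∣m*n P (fromℕ∣ (U P Q n) p∣Uₙ)))
        p∣Uₛ : p ∣ ∣ U P Q s ∣
        p∣Uₛ = p∤∣x∣⇒p∣∣x*y∣⇒p∣∣y∣ (+ 2 ℤ.* Q) (U P Q s) (p∤∣*∣ (+ 2) Q p∤2 p∤Q) p∣2QUₛ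

      p^μ+3∣Uₙ³ : p ^ (3 ℕ.+ μ) ∣ ∣ U P Q n ℤ.* (U P Q n ℤ.* U P Q n) ∣
      p^μ+3∣Uₙ³ = subst (p ^ (3 ℕ.+ μ) ∣_)
        (sym (trans (ℤP.abs-* (U P Q n) (U P Q n ℤ.* U P Q n)) (cong (∣ U P Q n ∣ ℕ.*_) (ℤP.abs-* (U P Q n) (U P Q n)))))
        (ℕD.*-pres-∣ p∣Uₙ (ℕD.*-pres-∣ p∣Uₙ (∥⇒∣ Uₙ-∥)))

      -- Modulo U_n^3 the congruence transfers any valuation up to ν_p(U_n) + 1 from its right-hand side.
      U-*-∥ : ∀ k {j} → j ≤ 2 ℕ.+ μ → p^ j ∥ ∣ + 2 ℤ.* + suc k ℤ.* V P Q n ℤ.^ k ℤ.* U P Q n ∣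
            → p^ j ∥ ∣ U P Q (suc k ℕ.* n) ∣
      U-*-∥ k {j} j≤μ+2 Y-∥ =
        ∥-cancelˡ (p∤∣^∣ (+ 2) (suc k) p∤2)
          (subst (p^ j ∥_) (ℤP.abs-* ((+ 2) ℤ.^ suc k) (U P Q (suc k ℕ.* n)))
            (∥-congruent ((+ 2) ℤ.^ suc k ℤ.* U P Q (suc k ℕ.* n)) (+ 2 ℤ.* + suc k ℤ.* V P Q n ℤ.^ k ℤ.* U P Q n)
              (ℤ∣.∣-trans p^j+1∣Uₙ³ (U-*-congruence k)) Y-∥))
        where
        p^j+1∣Uₙ³ : + (p ^ suc j) ℤ∣.∣ U P Q n ℤ.* (U P Q n ℤ.* U P Q n)
        p^j+1∣Uₙ³ = fromℕ∣ _ (ℕD.∣-trans (m≤n⇒x^m∣x^n p (ℕ.s≤s j≤μ+2)) p^μ+3∣Uₙ³)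

      ∣2kVᵏUₙ∣ : ∀ k → ∣ + 2 ℤ.* + suc k ℤ.* V P Q n ℤ.^ k ℤ.* U P Q n ∣ ≡ 2 ℕ.* suc k ℕ.* ∣ V P Q n ℤ.^ k ∣ ℕ.* ∣ U P Q n ∣
      ∣2kVᵏUₙ∣ k = begin
        ∣ + 2 ℤ.* + suc k ℤ.* V P Q n ℤ.^ k ℤ.* U P Q n ∣
          ≡⟨ ℤP.abs-* (+ 2 ℤ.* + suc k ℤ.* V P Q n ℤ.^ k) (U P Q n) ⟩
        ∣ + 2 ℤ.* + suc k ℤ.* V P Q n ℤ.^ k ∣ ℕ.* ∣ U P Q n ∣
          ≡⟨ cong (ℕ._* ∣ U P Q n ∣) (ℤP.abs-* (+ 2 ℤ.* + suc k) (V P Q n ℤ.^ k)) ⟩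
        ∣ + 2 ℤ.* + suc k ∣ ℕ.* ∣ V P Q n ℤ.^ k ∣ ℕ.* ∣ U P Q n ∣
          ≡⟨ cong (λ c → c ℕ.* ∣ V P Q n ℤ.^ k ∣ ℕ.* ∣ U P Q n ∣) (ℤP.abs-* (+ 2) (+ suc k)) ⟩
        2 ℕ.* suc k ℕ.* ∣ V P Q n ℤ.^ k ∣ ℕ.* ∣ U P Q n ∣ ∎
        where open ≡-Reasoning

      U-*-∥-coprime : ∀ k → ¬ p ∣ suc k → p^ suc μ ∥ ∣ U P Q (suc k ℕ.* n) ∣
      U-*-∥-coprime k p∤k+1 = U-*-∥ k (ℕP.n≤1+n (suc μ)) (subst (p^ suc μ ∥_) (sym (∣2kVᵏUₙ∣ k))
        (∥-*ˡ (p∤-* (p∤-* p∤2 p∤k+1) (p∤∣^∣ (V P Q n) k p∤Vₙ)) Uₙ-∥))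

      U-p*-∥ : p^ suc (suc μ) ∥ ∣ U P Q (p ℕ.* n) ∣
      U-p*-∥ = subst (λ c → p^ suc (suc μ) ∥ ∣ U P Q (c ℕ.* n) ∣) (ℕP.suc-pred p)
        (U-*-∥ (ℕ.pred p) ℕP.≤-refl (subst (p^ suc (suc μ) ∥_) (sym ∣2pVᵏUₙ∣)
          (∥-*ˡ (p∤-* p∤2 (p∤∣^∣ (V P Q n) (ℕ.pred p) p∤Vₙ)) (∥-p* Uₙ-∥))))
        where
        ∣2pVᵏUₙ∣ : ∣ + 2 ℤ.* + suc (ℕ.pred p) ℤ.* V P Q n ℤ.^ ℕ.pred p ℤ.* U P Q n ∣
                 ≡ 2 ℕ.* ∣ V P Q n ℤ.^ ℕ.pred p ∣ ℕ.* (p ℕ.* ∣ U P Q n ∣)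
        ∣2pVᵏUₙ∣ = trans (∣2kVᵏUₙ∣ (ℕ.pred p))
          (trans (cong (λ c → 2 ℕ.* c ℕ.* ∣ V P Q n ℤ.^ ℕ.pred p ∣ ℕ.* ∣ U P Q n ∣) (ℕP.suc-pred p))
            (rearrange p ∣ V P Q n ℤ.^ ℕ.pred p ∣ ∣ U P Q n ∣))
          where
          rearrange : ∀ p v w → 2 ℕ.* p ℕ.* v ℕ.* w ≡ 2 ℕ.* v ℕ.* (p ℕ.* w)
          rearrange = ℕ-Ring.solve-∀

    U-p^e*m*-∥ : ∀ s μ → p^ suc μ ∥ ∣ U P Q (suc s) ∣ → ∀ e {m} → ¬ p ∣ m
               → p^ (suc μ ℕ.+ e) ∥ ∣ U P Q (p ^ e ℕ.* m ℕ.* suc s) ∣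
    U-p^e*m*-∥ s μ Uₙ-∥ zero {zero} p∤m = contradiction (p ∣0) p∤m
    U-p^e*m*-∥ s μ Uₙ-∥ zero {suc k} p∤m =
      subst₂ (λ j i → p^ j ∥ ∣ U P Q (i ℕ.* suc s) ∣) (sym (ℕP.+-identityʳ (suc μ))) (sym (ℕP.*-identityˡ (suc k)))
        (MultiplesValuation.U-*-∥-coprime s μ Uₙ-∥ k p∤m)
    U-p^e*m*-∥ s μ Uₙ-∥ (suc e) {m} p∤m with p ^ e ℕ.* m ℕ.* suc s in index | U-p^e*m*-∥ s μ Uₙ-∥ e p∤m
    ... | zero | exactly _ p^j+1∤0 = contradiction (_ ∣0) p^j+1∤0
    ... | suc s' | U[p^e*m*n]-∥ =
      subst₂ (λ j i → p^ j ∥ ∣ U P Q i ∣) (cong suc (sym (ℕP.+-suc μ e))) p*[p^e*m*n]≡p^[e+1]*m*n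
        (MultiplesValuation.U-p*-∥ s' (μ ℕ.+ e) U[p^e*m*n]-∥)
      where
      p*[p^e*m*n]≡p^[e+1]*m*n : p ℕ.* suc s' ≡ p ^ suc e ℕ.* m ℕ.* suc s
      p*[p^e*m*n]≡p^[e+1]*m*n = trans (cong (p ℕ.*_) (sym index)) (reassoc p (p ^ e) m (suc s))
        where
        reassoc : ∀ p q m n → p ℕ.* (q ℕ.* m ℕ.* n) ≡ p ℕ.* q ℕ.* m ℕ.* n
        reassoc = ℕ-Ring.solve-∀

    p^T∣U[m*n]⇔ValGE : ∀ s μ → p^ suc μ ∥ ∣ U P Q (suc s) ∣ → ∀ T m → .{{NonZero m}}
                      → p ^ T ∣ ∣ U P Q (m ℕ.* suc s) ∣ ⇔ ValGE p m (+ T ℤ.- + suc μ)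
    p^T∣U[m*n]⇔ValGE s μ Uₙ-∥ T m with p-adic-decomposition m
    ... | e , m' , p∤m' , refl = begin
      p ^ T ∣ ∣ U P Q (p ^ e ℕ.* m' ℕ.* suc s) ∣ ∼⟨ p^j∥x⇒p^k∣x⇔k≤j (U-p^e*m*-∥ s μ Uₙ-∥ e p∤m') ⟩
      T ≤ suc μ ℕ.+ e                            ∼⟨ ⇔-sym (+m-+n≤+o⇔m≤n+o T (suc μ) e) ⟩
      + T ℤ.- + suc μ ℤ.≤ + e                    ∼⟨ ⇔-sym (p^e∥m⇒ValGE⇔≤ (p^e∥p^e*m e p∤m')) ⟩
      ValGE p (p ^ e ℕ.* m') (+ T ℤ.- + suc μ)   ∎
      where open Related.EquationalReasoning

    p^[1+T]∣U⇔∃m : ∀ {ρ ν} → IsRank p P Q ρ → IsVal p (U P Q ρ) ν → ∀ T n → .{{NonZero n}}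
             → p ^ suc T ∣ ∣ U P Q n ∣ ⇔ Σ ℕ λ m → n ≡ m ℕ.* ρ × ValGE∞ p m (+ suc T) ν
    p^[1+T]∣U⇔∃m {suc s} {∞} rank@(ℕ.s≤s _ , _) Uρ≡0 T n = mk⇔ to from
      where
      to : p ^ suc T ∣ ∣ U P Q n ∣ → Σ ℕ λ m → n ≡ m ℕ.* suc s × ⊤
      to p^T+1∣Uₙ with rank-∣ rank (ℕD.m*n∣⇒m∣ p (p ^ T) p^T+1∣Uₙ)
      ... | divides m n≡m*ρ = m , n≡m*ρ , tt
      from : (Σ ℕ λ m → n ≡ m ℕ.* suc s × ⊤) → p ^ suc T ∣ ∣ U P Q n ∣
      from (m , n≡m*ρ , _) with Multiples.U∣U-* s m
      ... | ℤ∣.divides q U[m*ρ]≡q*Uρ = subst (λ x → p ^ suc T ∣ ∣ x ∣) U[n]≡0 (_ ∣0)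
        where
        U[n]≡0 : + 0 ≡ U P Q n
        U[n]≡0 = sym (trans (cong (U P Q) n≡m*ρ) (trans U[m*ρ]≡q*Uρ (trans (cong (q ℤ.*_) Uρ≡0) (ℤP.*-zeroʳ q))))
    p^[1+T]∣U⇔∃m {ρ} {fin zero} (_ , p∣Uρ , _) (_ , _ , p∤Uρ) T n =
      contradiction (subst (λ d → d ∣ ∣ U P Q ρ ∣) (sym (ℕP.*-identityʳ p)) p∣Uρ) p∤Uρ
    p^[1+T]∣U⇔∃m {suc s} {fin (suc μ)} rank@(ℕ.s≤s _ , _) (_ , p^ν∣Uρ , p^ν+1∤Uρ) T n = mk⇔ to from
      where
      U[m*ρ]⇔ValGE : ∀ m → .{{NonZero m}} → p ^ suc T ∣ ∣ U P Q (m ℕ.* suc s) ∣ ⇔ ValGE p m (+ suc T ℤ.- + suc μ)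
      U[m*ρ]⇔ValGE = p^T∣U[m*n]⇔ValGE s μ (exactly p^ν∣Uρ p^ν+1∤Uρ) (suc T)
      to : p ^ suc T ∣ ∣ U P Q n ∣ → Σ ℕ λ m → n ≡ m ℕ.* suc s × ValGE∞ p m (+ suc T) (fin (suc μ))
      to p^T+1∣Uₙ with rank-∣ rank (ℕD.m*n∣⇒m∣ p (p ^ T) p^T+1∣Uₙ)
      ... | divides m n≡m*ρ = m , n≡m*ρ ,
        Equivalence.to (U[m*ρ]⇔ValGE m {{nonZero-factor m n≡m*ρ}}) (subst (λ i → p ^ suc T ∣ ∣ U P Q i ∣) n≡m*ρ p^T+1∣Uₙ)
      from : (Σ ℕ λ m → n ≡ m ℕ.* suc s × ValGE∞ p m (+ suc T) (fin (suc μ))) → p ^ suc T ∣ ∣ U P Q n ∣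
      from (m , n≡m*ρ , valGE) =
        subst (λ i → p ^ suc T ∣ ∣ U P Q i ∣) (sym n≡m*ρ) (Equivalence.from (U[m*ρ]⇔ValGE m {{nonZero-factor m n≡m*ρ}}) valGE)

module Characterisation
  {P Q : ℤ} {p : ℕ} (p-prime : Prime p) (p≥3 : 3 ≤ p) (a : ℕ) .{{_ : NonZero a}} {P' Q' : ℤ}
  (P≡p^aP' : P ≡ + (p ^ a) ℤ.* P') (Q≡p^2aQ' : Q ≡ + (p ^ (2 ℕ.* a)) ℤ.* Q')
  (p∤P'Q' : ¬ p ℕD.∣ ∣ P' ℤ.* Q' ∣) (r : ℕ) {ρ' : ℕ} {ν' : ℕ∞}
  (rank : IsRank p P' Q' ρ') (val : IsVal p (U P' Q' ρ') ν')
  where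
  open import Data.Nat.Divisibility using (_∣_; _∣0; ∣n⇒∣m*n)
  open PrimePowers p-prime

  c : ℕ
  c = ceilDiv (r ℕ.+ a) a

  InMultiplesOfRank : ℕ → Set
  InMultiplesOfRank n = Σ ℕ (λ m → (n ≡ m ℕ.* ρ') × ValGE∞ p m ((+ r) ℤ.+ (+ a) ℤ.- (+ (a ℕ.* n))) ν')

  p∤Q' : ¬ p ∣ ∣ Q' ∣
  p∤Q' p∣Q' = p∤P'Q' (subst (p ∣_) (sym (ℤP.abs-* P' Q')) (∣n⇒∣m*n ∣ P' ∣ p∣Q'))

  p∤2 : ¬ p ∣ 2
  p∤2 p∣2 = ℕP.<⇒≱ p≥3 (ℕD.∣⇒≤ p∣2)

  open LucasModuloPrime p-prime P' Q' p∤Q'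

  ∣U∣≡p^[a*n]*∣U'∣ : ∀ n → ∣ U P Q (suc n) ∣ ≡ p ^ (a ℕ.* n) ℕ.* ∣ U P' Q' (suc n) ∣
  ∣U∣≡p^[a*n]*∣U'∣ n = begin
    ∣ U P Q (suc n) ∣                                     ≡⟨ cong₂ (λ P Q → ∣ U P Q (suc n) ∣) P≡p^aP' Q≡p^a*p^a*Q' ⟩
    ∣ U (p^a ℤ.* P') (p^a ℤ.* p^a ℤ.* Q') (suc n) ∣       ≡⟨ cong ∣_∣ (U-scale p^a P' Q' n) ⟩
    ∣ p^a ℤ.^ n ℤ.* U P' Q' (suc n) ∣                     ≡⟨ ℤP.abs-* (p^a ℤ.^ n) (U P' Q' (suc n)) ⟩
    ∣ p^a ℤ.^ n ∣ ℕ.* ∣ U P' Q' (suc n) ∣                 ≡⟨ cong (ℕ._* ∣ U P' Q' (suc n) ∣) (∣+c^n∣≡c^n (p ^ a) n) ⟩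
    (p ^ a) ^ n ℕ.* ∣ U P' Q' (suc n) ∣                   ≡⟨ cong (ℕ._* ∣ U P' Q' (suc n) ∣) (ℕP.^-*-assoc p a n) ⟩
    p ^ (a ℕ.* n) ℕ.* ∣ U P' Q' (suc n) ∣                 ∎
    where
    open ≡-Reasoning
    p^a : ℤ
    p^a = + (p ^ a)
    Q≡p^a*p^a*Q' : Q ≡ p^a ℤ.* p^a ℤ.* Q'
    Q≡p^a*p^a*Q' = trans Q≡p^2aQ' (cong (ℤ._* Q') (trans (cong +_ p^2a≡p^a*p^a) (ℤP.pos-* (p ^ a) (p ^ a))))
      where
      p^2a≡p^a*p^a : p ^ (2 ℕ.* a) ≡ p ^ a ℕ.* p ^ a
      p^2a≡p^a*p^a = trans (ℕP.^-distribˡ-+-* p a (a ℕ.+ 0)) (cong (λ k → p ^ a ℕ.* p ^ k) (ℕP.+-identityʳ a))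

  InL⇔p^[r∸a*n]∣U' : ∀ n → InL P Q (pInv p p-prime r) (suc n) ⇔ p ^ (r ℕ.∸ a ℕ.* n) ∣ ∣ U P' Q' (suc n) ∣
  InL⇔p^[r∸a*n]∣U' n = begin
    InL P Q (pInv p p-prime r) (suc n)          ∼⟨ IsInt[x/1*1/d]⇔d∣x (U P Q (suc n)) (p ^ r) {{ℕP.m^n≢0 p r}} ⟩
    (p ^ r ∣ ∣ U P Q (suc n) ∣)                  ≡⟨ cong (p ^ r ∣_) (∣U∣≡p^[a*n]*∣U'∣ n) ⟩
    (p ^ r ∣ p ^ (a ℕ.* n) ℕ.* ∣ U P' Q' (suc n) ∣) ∼⟨ x^m∣x^n*y⇔x^[m∸n]∣y p r (a ℕ.* n) ∣ U P' Q' (suc n) ∣ ⟩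
    (p ^ (r ℕ.∸ a ℕ.* n) ∣ ∣ U P' Q' (suc n) ∣)   ∎
    where open Related.EquationalReasoning

  c≤1+n⇔r≤a*n : ∀ n → c ≤ suc n ⇔ r ≤ a ℕ.* n
  c≤1+n⇔r≤a*n n = begin
    c ≤ suc n                  ∼⟨ ceilDiv≤⇔≤* (r ℕ.+ a) a (suc n) ⟩
    r ℕ.+ a ≤ a ℕ.+ n ℕ.* a    ≡⟨ cong (_≤ a ℕ.+ n ℕ.* a) (ℕP.+-comm r a) ⟩
    a ℕ.+ r ≤ a ℕ.+ n ℕ.* a    ∼⟨ mk⇔ (ℕP.+-cancelˡ-≤ a r (n ℕ.* a)) (ℕP.+-monoʳ-≤ a) ⟩
    r ≤ n ℕ.* a                ≡⟨ cong (r ≤_) (ℕP.*-comm n a) ⟩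
    r ≤ a ℕ.* n                ∎
    where open Related.EquationalReasoning

  membership : ∀ n → InL P Q (pInv p p-prime r) n ⇔ (InS c n ⊎ InMultiplesOfRank n)
  membership zero = mk⇔ (λ _ → inj₁ (inj₁ refl))
    (λ _ → Equivalence.from (IsInt[x/1*1/d]⇔d∣x (+ 0) (p ^ r) {{ℕP.m^n≢0 p r}}) (_ ∣0))
  membership (suc n) with r ℕ.∸ a ℕ.* n in r∸a*n≡
  ... | zero = mk⇔
    (λ _ → inj₁ (inj₂ (Equivalence.from (c≤1+n⇔r≤a*n n) (ℕP.m∸n≡0⇒m≤n r∸a*n≡))))
    (λ _ → Equivalence.from (InL⇔p^[r∸a*n]∣U' n) (subst (λ k → p ^ k ∣ ∣ U P' Q' (suc n) ∣) (sym r∸a*n≡) (ℕD.1∣ _)))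
  ... | suc T = begin
    InL P Q (pInv p p-prime r) (suc n)                                    ∼⟨ InL⇔p^[r∸a*n]∣U' n ⟩
    (p ^ (r ℕ.∸ a ℕ.* n) ∣ ∣ U P' Q' (suc n) ∣)                           ≡⟨ cong (λ k → p ^ k ∣ ∣ U P' Q' (suc n) ∣) r∸a*n≡ ⟩
    (p ^ suc T ∣ ∣ U P' Q' (suc n) ∣)                                     ∼⟨ p^[1+T]∣U⇔∃m p∤2 rank val T (suc n) ⟩
    Σ ℕ (λ m → (suc n ≡ m ℕ.* ρ') × ValGE∞ p m (+ suc T) ν')
      ≡⟨ cong (λ t → Σ ℕ (λ m → (suc n ≡ m ℕ.* ρ') × ValGE∞ p m t ν')) (sym t≡1+T) ⟩
    InMultiplesOfRank (suc n)                                             ∼⟨ mk⇔ inj₂ [ (λ 1+n∈S → contradiction 1+n∈S 1+n∉S) , id ]′ ⟩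
    (InS c (suc n) ⊎ InMultiplesOfRank (suc n))                           ∎
    where
    open Related.EquationalReasoning
    r≰a*n : ¬ r ≤ a ℕ.* n
    r≰a*n r≤a*n with () ← trans (sym r∸a*n≡) (ℕP.m≤n⇒m∸n≡0 r≤a*n)
    1+n∉S : ¬ InS c (suc n)
    1+n∉S (inj₂ c≤1+n) = r≰a*n (Equivalence.to (c≤1+n⇔r≤a*n n) c≤1+n)
    t≡1+T : + r ℤ.+ + a ℤ.- + (a ℕ.* suc n) ≡ + suc T
    t≡1+T = trans (+r++a-+[a*[1+n]]≡+[r∸a*n] r a n (ℕP.<⇒≤ (ℕP.≰⇒> r≰a*n))) (cong +_ r∸a*n≡)

  multiples-of-rank⊆S : c ≤ ρ' → ∀ n → InMultiplesOfRank n → InS c n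
  multiples-of-rank⊆S _ n (zero , n≡0 , _) = inj₁ n≡0
  multiples-of-rank⊆S c≤ρ' n (suc m , n≡ρ'+m*ρ' , _) =
    inj₂ (ℕP.≤-trans c≤ρ' (subst (ρ' ≤_) (sym n≡ρ'+m*ρ') (ℕP.m≤m+n ρ' (m ℕ.* ρ'))))

  membership-when-c≤ρ' : c ≤ ρ' → ∀ n → InL P Q (pInv p p-prime r) n ⇔ InS c n
  membership-when-c≤ρ' c≤ρ' n = mk⇔
    ([ id , multiples-of-rank⊆S c≤ρ' n ]′ ∘ Equivalence.to (membership n))
    (Equivalence.from (membership n) ∘ inj₁)

theorem5p3 : (P Q : ℤ) → P ℤ.* Q ≢ + 0 →
    (p : ℕ) → (pp : Prime p) → 3 ≤ p →
    (+ p) ℤD.∣ P → (+ p) ℤD.∣ Q →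
    (a b : ℕ) → .{{_ : NonZero a}} → (P' Q' : ℤ) → 1 ≤ b →
    P ≡ (+ (p ^ a)) ℤ.* P' → Q ≡ (+ (p ^ b)) ℤ.* Q' →
    ¬ ((+ p) ℤD.∣ (P' ℤ.* Q')) →
    b ≡ 2 ℕ.* a →
    (r : ℕ) → 1 ≤ r →
    (ρ' : ℕ) → IsRank p P' Q' ρ' →
    (ν' : ℕ∞) → IsVal p (U P' Q' ρ') ν' →
    ((n : ℕ) →
        (InL P Q (pInv p pp r) n →
          (InS (ceilDiv (r ℕ.+ a) a) n
           ⊎ Σ ℕ (λ m → (n ≡ m ℕ.* ρ')
               × ValGE∞ p m ((+ r) ℤ.+ (+ a) ℤ.- (+ (a ℕ.* n))) ν')))
        × ((InS (ceilDiv (r ℕ.+ a) a) n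
           ⊎ Σ ℕ (λ m → (n ≡ m ℕ.* ρ')
               × ValGE∞ p m ((+ r) ℤ.+ (+ a) ℤ.- (+ (a ℕ.* n))) ν'))
          → InL P Q (pInv p pp r) n))
    × (ceilDiv (r ℕ.+ a) a ≤ ρ' →
       (n : ℕ) →
        (InL P Q (pInv p pp r) n → InS (ceilDiv (r ℕ.+ a) a) n)
        × (InS (ceilDiv (r ℕ.+ a) a) n → InL P Q (pInv p pp r) n))
theorem5p3 P Q _ p p-prime p≥3 _ _ a _ P' Q' _ P≡p^aP' Q≡p^2aQ' p∤P'Q' refl r _ ρ' rank ν' val =
  (λ n → to (membership n) , from (membership n)) ,
  (λ c≤ρ' n → to (membership-when-c≤ρ' c≤ρ' n) , from (membership-when-c≤ρ' c≤ρ' n))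
  where
  open Characterisation p-prime p≥3 a P≡p^aP' Q≡p^2aQ' p∤P'Q' r rank val
  open Equivalence
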